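{- Let $m,n\geqslant 7$, $i_1,\dots,i_m\in[n]$ distinct and $j_1,\dots,j_m\in[n]$ distinct. A vertex $P^{[2]}_\sigma$ of $\mathrm{QAP}_n$ satisfies the inequality $$\sum_{r=1}^{m}Y_{i_rj_r,i_rj_r}-\sum_{1\leqslant r<s\leqslant m}Y_{i_rj_r,i_sj_s}\leqslant 1$$ with equality if and only if $P^{[2]}_\sigma\in S_1\cup S_2$.
   Context: $P_\sigma$ is the $n\times n$ permutation matrix of $\sigma\in S_n$ ($P_\sigma(i,j)=1$ iff $\sigma(i)=j$); $n^2\times n^2$ matrices have rows/columns indexed by pairs $(ij)$, $Y_{ij,kl}$ the entry in row $(ij)$, column $(kl)$; $P^{[2]}_\sigma(ij,kl)=P_\sigma(i,j)P_\sigma(k,l)$; $\mathrm{QAP}_n=\mathrm{conv}\{P^{[2]}_\sigma:\sigma\in S_n\}$. For $0\leqslant k\leqslant m$, $S_k$ is the set of vertices $P^{[2]}_\sigma$ such that $\sigma(i_r)=j_r$ for exactly $k$ indices $r\in[m]$. -}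

module Defs where

open import Data.Nat using (ℕ; zero; suc)
open import Data.Fin using (Fin; zero; suc; _<_; _≟_; _<?_)
open import Data.Integer using (ℤ; _+_; _-_; _*_; +_)
open import Data.Product using (_×_; _,_)
open import Relation.Nullary.Decidable using (does)
open import Data.Bool using (if_then_else_)
open import Relation.Binary.PropositionalEquality using (_≡_)
open import Data.Fin.Permutation using (Permutation′; _⟨$⟩ʳ_)

Σ : ∀ {m} → (Fin m → ℤ) → ℤ
Σ {zero}  f = + 0
Σ {suc m} f = f zero + Σ (λ r → f (suc r))

δ : ∀ {n} → Fin n → Fin n → ℤ
δ a b = if does (a ≟ b) then + 1 else + 0

Mat2 : ℕ → Set
Mat2 n = Fin n × Fin n → Fin n × Fin n → ℤ

P : ∀ {n} → Permutation′ n → Fin n → Fin n → ℤ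
P σ i j = δ (σ ⟨$⟩ʳ i) j

P2 : ∀ {n} → Permutation′ n → Mat2 n
P2 σ (i , j) (k , l) = P σ i j * P σ k l

ineqLHS : ∀ {m n} → (Fin m → Fin n) → (Fin m → Fin n) → Mat2 n → ℤ
ineqLHS {m} i j Y =
  Σ (λ r → Y (i r , j r) (i r , j r))
  - Σ (λ r → Σ (λ s → if does (r <? s)
                         then Y (i r , j r) (i s , j s) else + 0))

hits : ∀ {m n} → (Fin m → Fin n) → (Fin m → Fin n) → Permutation′ n → ℕ
hits {zero}  i j σ = 0
hits {suc m} i j σ =
  (if does ((σ ⟨$⟩ʳ i zero) ≟ j zero) then 1 else 0)
  Data.Nat.+ hits (λ r → i (suc r)) (λ r → j (suc r)) σ

-- P^[2]_σ ∈ S_k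
InS : ∀ {m n} → (Fin m → Fin n) → (Fin m → Fin n) → ℕ → Permutation′ n → Set
InS i j k σ = hits i j σ ≡ k

-- At a vertex every entry of P^[2]_σ is a product of the 0/1 indicators
-- x_r = [σ(i_r) = j_r], and x_r² = x_r; so with k the number of hits the
-- left-hand side is Σ x_r - Σ_{r<s} x_r x_s = k - C(k,2), which is at most 1
-- and equals 1 exactly for k = 1, 2.
module Submission where

open import Defs
open import Data.Nat using (ℕ; _≤_; zero; suc; z≤n; s≤s) renaming (_+_ to _+ℕ_)
open import Data.Nat.Combinatorics using (_C_; nC1≡n; nCk+nC[k+1]≡[n+1]C[k+1])
open import Data.Fin using (Fin; zero; suc; _≟_; _<?_)
open import Data.Integer using (ℤ; +_; _+_; _-_; _*_; +≤+) renaming (_≤_ to _≤ℤ_)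
open import Data.Product using (_×_; _,_)
open import Data.Sum using (_⊎_; inj₁; inj₂)
open import Data.Bool using (Bool; true; false; if_then_else_)
open import Function using (_∘_)
open import Function.Definitions using (Injective)
open import Function.Bundles using (_⇔_; mk⇔)
open import Relation.Binary.PropositionalEquality
open import Relation.Nullary.Decidable using (does)
open import Data.Fin.Permutation using (Permutation′; _⟨$⟩ʳ_)
import Data.Nat.Properties as ℕ
import Data.Integer.Properties as ℤ

Σ-cong : ∀ {m} {f g : Fin m → ℤ} → (∀ r → f r ≡ g r) → Σ f ≡ Σ g
Σ-cong {zero}  e = refl
Σ-cong {suc m} e = cong₂ _+_ (e zero) (Σ-cong (e ∘ suc))

Σ-*-distribˡ : ∀ {m} (c : ℤ) (f : Fin m → ℤ) → Σ (λ r → c * f r) ≡ c * Σ f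
Σ-*-distribˡ {zero}  c f = sym (ℤ.*-zeroʳ c)
Σ-*-distribˡ {suc m} c f =
  trans (cong (λ t → c * f zero + t) (Σ-*-distribˡ c (f ∘ suc)))
        (sym (ℤ.*-distribˡ-+ c (f zero) (Σ (f ∘ suc))))

pairSum : ∀ {m} → (Fin m → ℤ) → ℤ
pairSum x = Σ (λ r → Σ (λ s → if does (r <? s) then x r * x s else + 0))

pairSum-suc : ∀ {m} (x : Fin (suc m) → ℤ) →
              pairSum x ≡ x zero * Σ (x ∘ suc) + pairSum (x ∘ suc)
pairSum-suc {m} x =
  cong₂ _+_ (trans (ℤ.+-identityˡ _) (Σ-*-distribˡ (x zero) (x ∘ suc)))
            (Σ-cong {f = λ r → + 0 + row r} (λ r → ℤ.+-identityˡ (row r)))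
  where
  row : Fin m → ℤ
  row r = Σ (λ s → if does (r <? s) then x (suc r) * x (suc s) else + 0)

ind : Bool → ℤ
ind b = if b then + 1 else + 0

count : ∀ {m} → (Fin m → Bool) → ℕ
count {zero}  b = 0
count {suc m} b = (if b zero then 1 else 0) +ℕ count (b ∘ suc)

ind*ind≡ind : ∀ b → ind b * ind b ≡ ind b
ind*ind≡ind true  = refl
ind*ind≡ind false = refl

Σ-ind≡count : ∀ {m} (b : Fin m → Bool) → Σ (ind ∘ b) ≡ + count b
Σ-ind≡count {zero}  b = refl
Σ-ind≡count {suc m} b = trans (cong (_+_ (ind (b zero))) (Σ-ind≡count (b ∘ suc))) (head (b zero))
  where
  head : ∀ x → ind x + + count (b ∘ suc) ≡ + ((if x then 1 else 0) +ℕ count (b ∘ suc))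
  head true  = refl
  head false = refl

suc-C-2 : ∀ k → suc k C 2 ≡ k +ℕ k C 2
suc-C-2 k = trans (sym (nCk+nC[k+1]≡[n+1]C[k+1] k 1)) (cong (_+ℕ k C 2) (nC1≡n k))

pairSum-ind≡count-C-2 : ∀ {m} (b : Fin m → Bool) → pairSum (ind ∘ b) ≡ + (count b C 2)
pairSum-ind≡count-C-2 {zero}  b = refl
pairSum-ind≡count-C-2 {suc m} b = begin
  pairSum (ind ∘ b)
    ≡⟨ pairSum-suc (ind ∘ b) ⟩
  ind (b zero) * Σ (ind ∘ b ∘ suc) + pairSum (ind ∘ b ∘ suc)
    ≡⟨ cong₂ (λ s p → ind (b zero) * s + p) (Σ-ind≡count (b ∘ suc)) (pairSum-ind≡count-C-2 (b ∘ suc)) ⟩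
  ind (b zero) * + c + + (c C 2)
    ≡⟨ head (b zero) ⟩
  + (count b C 2)
    ∎
  where
  open ≡-Reasoning
  c : ℕ
  c = count (b ∘ suc)
  head : ∀ x → ind x * + c + + (c C 2) ≡ + (((if x then 1 else 0) +ℕ c) C 2)
  head true  = trans (cong (_+ + (c C 2)) (ℤ.*-identityˡ (+ c))) (cong +_ (sym (suc-C-2 c)))
  head false = refl

≤-C-2 : ∀ k → 3 +ℕ k ≤ (3 +ℕ k) C 2
≤-C-2 k = begin
  3 +ℕ k                             ≡⟨ ℕ.+-comm 1 (2 +ℕ k) ⟩
  (2 +ℕ k) +ℕ 1                      ≤⟨ ℕ.+-monoʳ-≤ (2 +ℕ k) (s≤s z≤n) ⟩
  (2 +ℕ k) +ℕ (suc k +ℕ suc k C 2)   ≡⟨ cong ((2 +ℕ k) +ℕ_) (sym (suc-C-2 (suc k))) ⟩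
  (2 +ℕ k) +ℕ (2 +ℕ k) C 2           ≡⟨ sym (suc-C-2 (2 +ℕ k)) ⟩
  (3 +ℕ k) C 2                       ∎
  where open ℕ.≤-Reasoning

k-C-2≤1 : ∀ k → + k - + (k C 2) ≤ℤ + 1
k-C-2≤1 0 = +≤+ z≤n
k-C-2≤1 1 = ℤ.≤-refl
k-C-2≤1 2 = ℤ.≤-refl
k-C-2≤1 (suc (suc (suc k))) = ℤ.≤-trans (ℤ.i≤j⇒i-j≤0 (+≤+ (≤-C-2 k))) (+≤+ z≤n)

k-C-2≡1⇔ : ∀ k → (+ k - + (k C 2) ≡ + 1) ⇔ (k ≡ 1 ⊎ k ≡ 2)
k-C-2≡1⇔ 0 = mk⇔ (λ ()) λ { (inj₁ ()) ; (inj₂ ()) }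
k-C-2≡1⇔ 1 = mk⇔ (λ _ → inj₁ refl) (λ _ → refl)
k-C-2≡1⇔ 2 = mk⇔ (λ _ → inj₂ refl) (λ _ → refl)
k-C-2≡1⇔ (suc (suc (suc k))) = mk⇔ impossible λ { (inj₁ ()) ; (inj₂ ()) }
  where
  impossible : + (3 +ℕ k) - + ((3 +ℕ k) C 2) ≡ + 1 → 3 +ℕ k ≡ 1 ⊎ 3 +ℕ k ≡ 2
  impossible e with subst (_≤ℤ + 0) e (ℤ.i≤j⇒i-j≤0 (+≤+ (≤-C-2 k)))
  ... | +≤+ ()

hits≡count : ∀ {m n} (i j : Fin m → Fin n) (σ : Permutation′ n) →
             hits i j σ ≡ count (λ r → does ((σ ⟨$⟩ʳ i r) ≟ j r))
hits≡count {zero}  i j σ = refl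
hits≡count {suc m} i j σ = cong₂ _+ℕ_ refl (hits≡count (i ∘ suc) (j ∘ suc) σ)

lemma1 : (m n : ℕ) → 7 ≤ m → 7 ≤ n →
         (i j : Fin m → Fin n) → Injective _≡_ _≡_ i → Injective _≡_ _≡_ j →
         (σ : Permutation′ n) →
         (ineqLHS i j (P2 σ) ≤ℤ + 1)
         × (ineqLHS i j (P2 σ) ≡ + 1 ⇔ (InS i j 1 σ ⊎ InS i j 2 σ))
lemma1 m n _ _ i j _ _ σ = subst (λ l → (l ≤ℤ + 1) × (l ≡ + 1 ⇔ (InS i j 1 σ ⊎ InS i j 2 σ)))
                                 (sym lhs≡) (k-C-2≤1 k , k-C-2≡1⇔ k)
  where
  hit : Fin m → Bool
  hit r = does ((σ ⟨$⟩ʳ i r) ≟ j r)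
  k : ℕ
  k = hits i j σ
  lhs≡ : ineqLHS i j (P2 σ) ≡ + k - + (k C 2)
  lhs≡ = begin
    ineqLHS i j (P2 σ)                                          ≡⟨⟩
    Σ (λ r → ind (hit r) * ind (hit r)) - pairSum (ind ∘ hit)
      ≡⟨ cong₂ _-_ (trans (Σ-cong (ind*ind≡ind ∘ hit)) (Σ-ind≡count hit))
                   (pairSum-ind≡count-C-2 hit) ⟩
    + count hit - + (count hit C 2)
      ≡⟨ cong (λ h → + h - + (h C 2)) (sym (hits≡count i j σ)) ⟩
    + k - + (k C 2)                                             ∎
    where open ≡-Reasoning
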